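{- Let $G$ be a finite simple undirected graph with an edge coloring $c: E(G) \to \mathbb{N}$, and let $k$ be an integer such that $d^c(v) \geq k$ for every vertex $v \in V(G)$. Then for every vertex $x$ of $G$ there exists a rainbow path of length at least $\left\lceil \frac{k+1}{2} \right\rceil$ starting from $x$.
   Context: An edge coloring of $G$ is an arbitrary map $c: E(G)\to\mathbb{N}$ (adjacent edges may share colors). The color degree $d^c(v)$ of a vertex $v$ is the number of distinct colors appearing on edges incident to $v$. A rainbow path is a path in which all edges have pairwise distinct colors. The length of a path is its number of edges. -}

module Defs where

open import Data.Nat using (ℕ; zero; suc; _+_; _/_)
open import Data.Fin using (Fin)
open import Data.Fin.Properties using (all?)
open import Data.List using (List; []; _∷_; length; filter; map; deduplicate)
open import Data.List.Relation.Unary.Unique.Propositional using (Unique)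
open import Data.List.Relation.Unary.Linked using (Linked)
open import Data.List.Base using (allFin)
open import Data.Nat.Properties using (_≟_)
open import Relation.Nullary using (Dec; ¬_)
open import Relation.Binary.PropositionalEquality using (_≡_)
open import Data.Product using (Σ; _×_)
open import Relation.Unary using (Decidable)

record Graph (n : ℕ) : Set₁ where
  field
    Adj     : Fin n → Fin n → Set
    adj?    : (u v : Fin n) → Dec (Adj u v)
    symm    : ∀ {u v} → Adj u v → Adj v u
    irrefl  : ∀ {u} → ¬ Adj u u
open Graph public

-- An edge coloring c : E(G) → ℕ, represented as a function on ordered
-- pairs that is symmetric (so it only depends on the unordered edge);
-- values on non-adjacent pairs are irrelevant.
record EdgeColoring {n : ℕ} (G : Graph n) : Set where
  field
    col     : Fin n → Fin n → ℕ
    colSym  : ∀ {u v} → Adj G u v → col u v ≡ col v u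
open EdgeColoring public

neighbours : ∀ {n} (G : Graph n) → Fin n → List (Fin n)
neighbours G v = filter (λ u → adj? G v u) (allFin _)

colorDegree : ∀ {n} {G : Graph n} → EdgeColoring G → Fin n → ℕ
colorDegree {G = G} c v =
  length (deduplicate _≟_ (map (λ u → col c v u) (neighbours G v)))

edgeColors : ∀ {n} {G : Graph n} → EdgeColoring G → List (Fin n) → List ℕ
edgeColors c []            = []
edgeColors c (u ∷ [])      = []
edgeColors c (u ∷ v ∷ vs)  = col c u v ∷ edgeColors c (v ∷ vs)

record IsPath {n : ℕ} (G : Graph n) (vs : List (Fin n)) : Set where
  field
    distinct : Unique vs
    walk     : Linked (Adj G) vs

IsRainbow : ∀ {n} {G : Graph n} → EdgeColoring G → List (Fin n) → Set
IsRainbow c vs = Unique (edgeColors c vs)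

pathLength : ∀ {A : Set} → List A → ℕ
pathLength []       = 0
pathLength (_ ∷ vs) = length vs

-- ⌈(k+1)/2⌉ for k : ℕ equals ⌊(k+2)/2⌋.
ceilHalfSuc : ℕ → ℕ
ceilHalfSuc k = (k + 2) / 2

-- Grow a rainbow path from x greedily until its end v admits no extension. Then
-- every neighbour u of v lies on the path or c(vu) already occurs on it, so
-- every color at v is the color of an edge from v to the path or of a path edge
-- not incident to v. A path with m edges offers at most m + (m - 1) such colors,
-- hence k ≤ 2m - 1.
module Submission where

open import Defs
open import Data.Nat using (ℕ; zero; suc; pred; _+_; _*_; _≤_; z≤n; s≤s; s≤s⁻¹)
open import Data.Nat.Properties using (≤-trans; ≤-reflexive; <-irrefl; +-suc; +-monoˡ-≤; m≤m+n)
import Data.Nat.Properties as ℕ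
open import Data.Nat.DivMod using (m<n*o⇒m/o<n)
open import Data.Nat.Tactic.RingSolver using (solve-∀)
open import Data.Fin using (Fin)
import Data.Fin.Properties as Fin
open import Data.List using (List; []; _∷_; [_]; _++_; _∷ʳ_; length; map; reverse; allFin; deduplicate)
open import Data.List.Base using (reverseAcc)
open import Data.List.Properties using (length-removeAt′; length-reverse; length-tabulate; reverse-++; length-++; length-map)
open import Data.List.Relation.Unary.Any using (here; there; index; _─_)
open import Data.List.Relation.Unary.All using ([]) renaming (lookup to lookupᴬ)
open import Data.List.Relation.Unary.AllPairs using ([]; _∷_)
open import Data.List.Relation.Unary.Linked using (Linked; []; [-]; _∷_)
open import Data.List.Relation.Unary.Unique.Propositional using (Unique)
open import Data.List.Relation.Unary.All.Properties using (¬Any⇒All¬)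
import Data.List.Relation.Unary.Unique.DecPropositional.Properties as UniqueDec
open import Data.List.Relation.Binary.Subset.Propositional using (_⊆_)
open import Data.List.Relation.Binary.Permutation.Propositional using (↭-sym; ↭⇒↭ₛ)
open import Data.List.Relation.Binary.Permutation.Propositional.Properties using (↭-reverse)
import Data.List.Relation.Binary.Permutation.Setoid.Properties as Permutation
open import Data.List.Membership.Propositional using (_∈_; _∉_)
open import Data.List.Membership.Propositional.Properties using (∈-map⁺; ∈-map⁻; ∈-++⁺ˡ; ∈-++⁺ʳ; ∈-filter⁻; ∈-allFin; ∈-deduplicate⁻)
import Data.List.Membership.DecPropositional as DecMembership
open import Data.Product using (Σ; _×_; _,_; proj₁; proj₂)
open import Data.Sum using (_⊎_; inj₁; inj₂)
open import Data.Empty using (⊥-elim)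
open import Relation.Nullary using (¬_; yes; no; Dec)
open import Relation.Nullary.Decidable using (_×-dec_; ¬?)
open import Relation.Binary.Definitions using (Symmetric)
open import Relation.Binary.PropositionalEquality hiding ([_])

module _ {A : Set} where

  ∈-─ : ∀ {x y} {ys : List A} (x∈ys : x ∈ ys) → y ∈ ys → y ≢ x → y ∈ (ys ─ x∈ys)
  ∈-─ (here refl)  (here refl)  y≢x = ⊥-elim (y≢x refl)
  ∈-─ (here _)     (there y∈ys) _   = y∈ys
  ∈-─ (there _)    (here y≡z)   _   = here y≡z
  ∈-─ (there x∈ys) (there y∈ys) y≢x = there (∈-─ x∈ys y∈ys y≢x)

  Unique-⊆⇒length≤ : ∀ {xs ys : List A} → Unique xs → xs ⊆ ys → length xs ≤ length ys
  Unique-⊆⇒length≤ {[]}     _               _   = z≤n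
  Unique-⊆⇒length≤ {x ∷ xs} {ys} (x∉xs ∷ u) sub = begin
    suc (length xs)          ≤⟨ s≤s (Unique-⊆⇒length≤ u sub′) ⟩
    suc (length (ys ─ x∈ys)) ≡⟨ length-removeAt′ ys (index x∈ys) ⟨
    length ys                ∎
    where
    open ℕ.≤-Reasoning
    x∈ys : x ∈ ys
    x∈ys = sub (here refl)
    sub′ : xs ⊆ (ys ─ x∈ys)
    sub′ y∈xs = ∈-─ x∈ys (sub (there y∈xs)) (λ y≡x → lookupᴬ x∉xs y∈xs (sym y≡x))

  Unique-reverse : ∀ {xs : List A} → Unique xs → Unique (reverse xs)
  Unique-reverse {xs} = Permutation.Unique-resp-↭ (setoid A) (↭⇒↭ₛ (↭-sym (↭-reverse xs)))

  module _ {R : A → A → Set} (sym-R : Symmetric R) where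

    Linked-reverseAcc : ∀ {x} acc xs → Linked R (x ∷ acc) → Linked R (x ∷ xs) →
                        Linked R (reverseAcc (x ∷ acc) xs)
    Linked-reverseAcc acc []       racc _           = racc
    Linked-reverseAcc acc (y ∷ xs) racc (rxy ∷ rxs) =
      Linked-reverseAcc (_ ∷ acc) xs (sym-R rxy ∷ racc) rxs

    Linked-reverse : ∀ {xs} → Linked R xs → Linked R (reverse xs)
    Linked-reverse {[]}     _   = []
    Linked-reverse {x ∷ xs} rxs = Linked-reverseAcc [] xs [-] rxs

  pathLength≡pred∘length : ∀ (xs : List A) → pathLength xs ≡ pred (length xs)
  pathLength≡pred∘length []      = refl
  pathLength≡pred∘length (_ ∷ _) = refl

  pathLength-reverse : ∀ (xs : List A) → pathLength (reverse xs) ≡ pathLength xs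
  pathLength-reverse xs = begin
    pathLength (reverse xs)    ≡⟨ pathLength≡pred∘length (reverse xs) ⟩
    pred (length (reverse xs)) ≡⟨ cong pred (length-reverse xs) ⟩
    pred (length xs)           ≡⟨ pathLength≡pred∘length xs ⟨
    pathLength xs              ∎
    where open ≡-Reasoning

ceilHalfSuc≤ : ∀ {k m} → 1 ≤ k → k ≤ m + pred m → ceilHalfSuc k ≤ m
ceilHalfSuc≤ {m = zero}  1≤k k≤0 = ⊥-elim (<-irrefl refl (≤-trans 1≤k k≤0))
ceilHalfSuc≤ {k} {suc m} _ k≤ =
  s≤s⁻¹ (m<n*o⇒m/o<n (≤-trans (+-monoˡ-≤ 2 (s≤s k≤)) (≤-reflexive (identity m))))
  where
  identity : ∀ m → suc (suc m + m) + 2 ≡ suc (suc m) * 2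
  identity = solve-∀

module _ {n : ℕ} (G : Graph n) (c : EdgeColoring G) where

  RainbowPath : List (Fin n) → Set
  RainbowPath vs = IsPath G vs × IsRainbow c vs

  edgeColors-reverseAcc : ∀ {x} acc xs → Linked (Adj G) (x ∷ xs) →
    edgeColors c (reverseAcc (x ∷ acc) xs) ≡
    reverseAcc (edgeColors c (x ∷ acc)) (edgeColors c (x ∷ xs))
  edgeColors-reverseAcc     acc []       _          = refl
  edgeColors-reverseAcc {x} acc (y ∷ xs) (xy ∷ rxs) = begin
    edgeColors c (reverseAcc (y ∷ x ∷ acc) xs)
      ≡⟨ edgeColors-reverseAcc (x ∷ acc) xs rxs ⟩
    reverseAcc (col c y x ∷ edgeColors c (x ∷ acc)) (edgeColors c (y ∷ xs))
      ≡⟨ cong (λ z → reverseAcc (z ∷ edgeColors c (x ∷ acc)) (edgeColors c (y ∷ xs))) (colSym c xy) ⟨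
    reverseAcc (col c x y ∷ edgeColors c (x ∷ acc)) (edgeColors c (y ∷ xs)) ∎
    where open ≡-Reasoning

  edgeColors-reverse : ∀ {vs} → Linked (Adj G) vs →
                       edgeColors c (reverse vs) ≡ reverse (edgeColors c vs)
  edgeColors-reverse {[]}     _ = refl
  edgeColors-reverse {v ∷ vs} w = edgeColors-reverseAcc [] vs w

  RainbowPath-reverse : ∀ {vs} → RainbowPath vs → RainbowPath (reverse vs)
  RainbowPath-reverse (path , rainbow) =
      record { distinct = Unique-reverse (IsPath.distinct path)
             ; walk     = Linked-reverse (symm G) (IsPath.walk path) }
    , subst Unique (sym (edgeColors-reverse (IsPath.walk path))) (Unique-reverse rainbow)

  length≤n : ∀ {vs} → IsPath G vs → length vs ≤ n
  length≤n {vs} path = subst (length vs ≤_) (length-tabulate (λ i → i))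
    (Unique-⊆⇒length≤ (IsPath.distinct path) (λ {a} _ → ∈-allFin a))

  -- Paths are grown at their head, so `v ∷ rest` lists a path backwards from its end v.
  Extends : Fin n → List (Fin n) → Fin n → Set
  Extends v rest u = Adj G v u × u ∉ v ∷ rest × col c v u ∉ edgeColors c (v ∷ rest)

  open DecMembership (Fin._≟_ {n}) using () renaming (_∈?_ to _∈ⱽ?_)
  open DecMembership ℕ._≟_ using () renaming (_∈?_ to _∈ᶜ?_)

  extends? : ∀ v rest u → Dec (Extends v rest u)
  extends? v rest u =
    adj? G v u ×-dec ¬? (u ∈ⱽ? v ∷ rest) ×-dec ¬? (col c v u ∈ᶜ? edgeColors c (v ∷ rest))

  RainbowPath-extend : ∀ {v rest u} → RainbowPath (v ∷ rest) → Extends v rest u →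
                       RainbowPath (u ∷ v ∷ rest)
  RainbowPath-extend {v} {rest} (path , rainbow) (vu , u∉ , vu∉) =
      record { distinct = ¬Any⇒All¬ _ u∉ ∷ IsPath.distinct path
             ; walk     = symm G vu ∷ IsPath.walk path }
    , ¬Any⇒All¬ _ (λ uv∈ → vu∉ (subst (_∈ edgeColors c (v ∷ rest)) (sym (colSym c vu)) uv∈))
      ∷ rainbow

  -- The first path edge v–p is counted once, in the map part; this saving is what
  -- yields ⌈(k+1)/2⌉ rather than ⌈k/2⌉.
  blockedColors : Fin n → List (Fin n) → List ℕ
  blockedColors v rest = map (col c v) rest ++ edgeColors c rest

  length-edgeColors : ∀ vs → length (edgeColors c vs) ≡ pred (length vs)
  length-edgeColors []           = refl
  length-edgeColors (_ ∷ [])     = refl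
  length-edgeColors (_ ∷ w ∷ vs) = cong suc (length-edgeColors (w ∷ vs))

  length-blockedColors : ∀ v rest →
                         length (blockedColors v rest) ≡ length rest + pred (length rest)
  length-blockedColors v rest = begin
    length (map (col c v) rest ++ edgeColors c rest)
      ≡⟨ length-++ (map (col c v) rest) ⟩
    length (map (col c v) rest) + length (edgeColors c rest)
      ≡⟨ cong₂ _+_ (length-map (col c v) rest) (length-edgeColors rest) ⟩
    length rest + pred (length rest) ∎
    where open ≡-Reasoning

  blockedColors⁺ : ∀ {v rest u} → Adj G v u →
                   u ∈ v ∷ rest ⊎ col c v u ∈ edgeColors c (v ∷ rest) →
                   col c v u ∈ blockedColors v rest
  blockedColors⁺ vu (inj₁ (here refl)) = ⊥-elim (irrefl G vu)
  blockedColors⁺ {v} {rest} _ (inj₁ (there u∈rest)) =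
    ∈-++⁺ˡ {ys = edgeColors c rest} (∈-map⁺ (col c v) u∈rest)
  blockedColors⁺ {rest = rest@(_ ∷ _)} _ (inj₂ (here vu≡vp)) =
    ∈-++⁺ˡ {ys = edgeColors c rest} (here vu≡vp)
  blockedColors⁺ {v} {rest@(_ ∷ _)} _ (inj₂ (there vu∈)) =
    ∈-++⁺ʳ (map (col c v) rest) vu∈

  ¬Extends⇒blocked : ∀ {v rest u} → Adj G v u → ¬ Extends v rest u →
                     col c v u ∈ blockedColors v rest
  ¬Extends⇒blocked {v} {rest} {u} vu ¬ext
    with u ∈ⱽ? v ∷ rest | col c v u ∈ᶜ? edgeColors c (v ∷ rest)
  ... | yes u∈  | _       = blockedColors⁺ vu (inj₁ u∈)
  ... | no _    | yes vu∈ = blockedColors⁺ vu (inj₂ vu∈)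
  ... | no u∉   | no vu∉  = ⊥-elim (¬ext (vu , u∉ , vu∉))

  colorDegree≤blocked : ∀ {v rest} → (∀ u → ¬ Extends v rest u) →
                        colorDegree c v ≤ length (blockedColors v rest)
  colorDegree≤blocked {v} {rest} stuck =
    Unique-⊆⇒length≤ (UniqueDec.deduplicate-! ℕ._≟_ _) color∈blocked
    where
    color∈blocked : deduplicate ℕ._≟_ (map (col c v) (neighbours G v)) ⊆ blockedColors v rest
    color∈blocked a∈ with ∈-map⁻ (col c v) (∈-deduplicate⁻ ℕ._≟_ _ a∈)
    ... | u , u∈nbrs , refl =
      ¬Extends⇒blocked (proj₂ (∈-filter⁻ (adj? G v) {xs = allFin n} u∈nbrs)) (stuck u)

  record MaximalRainbowPath (x : Fin n) : Set where
    field
      end     : Fin n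
      rest    : List (Fin n)
      init    : List (Fin n)
      ends-at : end ∷ rest ≡ init ∷ʳ x
      rainbow : RainbowPath (end ∷ rest)
      stuck   : ∀ u → ¬ Extends end rest u

  -- The fuel bounds the number of possible extensions, since a path has at most n vertices.
  extendGreedily : ∀ {x} fuel v rest init → n ≤ fuel + length rest →
                   v ∷ rest ≡ init ∷ʳ x → RainbowPath (v ∷ rest) → MaximalRainbowPath x
  extendGreedily zero v rest _ n≤ _ rp = ⊥-elim (<-irrefl refl (≤-trans (length≤n (proj₁ rp)) n≤))
  extendGreedily (suc fuel) v rest init n≤ eq rp with Fin.any? (extends? v rest)
  ... | no ¬ext       = record { end = v ; rest = rest ; init = init ; ends-at = eq ; rainbow = rp
                               ; stuck = λ u ext → ¬ext (u , ext) }
  ... | yes (u , ext) =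
    extendGreedily fuel u (v ∷ rest) (u ∷ init) (subst (n ≤_) (sym (+-suc fuel (length rest))) n≤)
      (cong (u ∷_) eq) (RainbowPath-extend rp ext)

  maximalRainbowPath : ∀ x → MaximalRainbowPath x
  maximalRainbowPath x = extendGreedily n x [] [] (m≤m+n n 0) refl
    (record { distinct = [] ∷ [] ; walk = [-] } , [])

lemma1 : ∀ {n : ℕ} (G : Graph n) (c : EdgeColoring G) (k : ℕ) →
    1 ≤ k →
    (∀ (v : Fin n) → k ≤ colorDegree c v) →
    ∀ (x : Fin n) →
      Σ (List (Fin n)) λ vs →
        IsPath G (x ∷ vs) × IsRainbow c (x ∷ vs) × ceilHalfSuc k ≤ pathLength (x ∷ vs)
lemma1 G c k 1≤k degree x =
  reverse init , proj₁ reversed-rainbow , proj₂ reversed-rainbow , reversed-long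
  where
  open MaximalRainbowPath (maximalRainbowPath G c x)

  reversed : reverse (end ∷ rest) ≡ x ∷ reverse init
  reversed = trans (cong reverse ends-at) (reverse-++ init [ x ])

  reversed-rainbow : RainbowPath G c (x ∷ reverse init)
  reversed-rainbow = subst (RainbowPath G c) reversed (RainbowPath-reverse G c rainbow)

  long : ceilHalfSuc k ≤ length rest
  long = ceilHalfSuc≤ 1≤k (begin
    k                                   ≤⟨ degree end ⟩
    colorDegree c end                   ≤⟨ colorDegree≤blocked G c stuck ⟩
    length (blockedColors G c end rest) ≡⟨ length-blockedColors G c end rest ⟩
    length rest + pred (length rest)    ∎)
    where open ℕ.≤-Reasoning

  reversed-long : ceilHalfSuc k ≤ pathLength (x ∷ reverse init)
  reversed-long = subst (ceilHalfSuc k ≤_)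
    (trans (sym (pathLength-reverse (end ∷ rest))) (cong pathLength reversed)) long
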